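{- Let $\dot G\in\mathcal{C}_1\cup\mathcal{C}_4\cup\mathcal{C}_5$ be a connected, non-complete, $5$-regular and $1$ net-regular strongly regular signed graph on $n$ vertices with parameters $(n,5,a,b,c)$. If $(a,b)=(2,0)$, then $4$ divides $n$.
   Context: A signed graph $\dot G=(G,\sigma)$ is a simple graph $G$ (its underlying graph) with a sign function $\sigma:E(G)\to\{+1,-1\}$; its adjacency matrix $A_{\dot G}$ has $(i,j)$ entry $\sigma(v_iv_j)$ if $v_i\sim v_j$ and $0$ otherwise. Degree is the degree in $G$; $d^\pm(v)$ are the numbers of positive/negative edges at $v$; the net-degree is $d^+(v)-d^-(v)$, and $\dot G$ is $\rho$ net-regular if all net-degrees equal $\rho$. Connected/complete refer to $G$. $\dot G$ is homogeneous if all edges have the same sign, inhomogeneous otherwise. A signed graph on $n$ vertices is strongly regular (SRSG) if it is neither homogeneous complete nor edgeless and there are $r\in\mathbb N$, $a,b,c\in\mathbb Z$ with $(A^2_{\dot G})_{ii}=r$, $(A^2_{\dot G})_{ij}=a$ for positive edges $v_iv_j$, $=b$ for negative edges, $=c$ for distinct non-adjacent $v_i,v_j$; parameters $(n,r,a,b,c)$. Inhomogeneous SRSGs are divided into classes: $\mathcal{C}_1$: $a=-b$, and either complete or non-complete with $c\neq 0$; $\mathcal{C}_4$: $a\neq -b$, non-complete with $c=0$; $\mathcal{C}_5$: $a\ne -b$, non-complete with $c\neq\frac{a+b}{2}$ and $c\neq 0$. -}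

module Defs where

open import Data.Nat as ℕ using (ℕ)
open import Data.Integer as ℤ using (ℤ; +_; -_; ∣_∣)
open import Data.Fin using (Fin; zero; suc)
open import Data.Product using (_×_; Σ; ∃)
open import Data.Sum using (_⊎_)
open import Relation.Binary.PropositionalEquality using (_≡_; _≢_)
open import Relation.Nullary using (¬_)
open import Relation.Binary.Construct.Closure.ReflexiveTransitive using (Star)

Σℤ : (n : ℕ) → (Fin n → ℤ) → ℤ
Σℤ ℕ.zero    f = + 0
Σℤ (ℕ.suc n) f = f zero ℤ.+ Σℤ n (λ k → f (suc k))

Σℕ : (n : ℕ) → (Fin n → ℕ) → ℕ
Σℕ ℕ.zero    f = 0
Σℕ (ℕ.suc n) f = f zero ℕ.+ Σℕ n (λ k → f (suc k))

IsSign : ℤ → Set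
IsSign x = (x ≡ + 0) ⊎ (x ≡ + 1) ⊎ (x ≡ - (+ 1))

record SignedGraph (n : ℕ) : Set where
  field
    A     : Fin n → Fin n → ℤ
    entry : ∀ i j → IsSign (A i j)
    symm  : ∀ i j → A i j ≡ A j i
    loopless : ∀ i → A i i ≡ + 0

module _ {n : ℕ} (G : SignedGraph n) where
  open SignedGraph G

  Adj : Fin n → Fin n → Set
  Adj i j = A i j ≢ + 0

  PosEdge NegEdge : Fin n → Fin n → Set
  PosEdge i j = A i j ≡ + 1
  NegEdge i j = A i j ≡ - (+ 1)

  A² : Fin n → Fin n → ℤ
  A² i j = Σℤ n (λ k → A i k ℤ.* A k j)

  degree : Fin n → ℕ
  degree i = Σℕ n (λ k → ∣ A i k ∣)

  netDegree : Fin n → ℤ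
  netDegree i = Σℤ n (λ k → A i k)

  Regular : ℕ → Set
  Regular r = ∀ i → degree i ≡ r

  NetRegular : ℤ → Set
  NetRegular ρ = ∀ i → netDegree i ≡ ρ

  Connected : Set
  Connected = ∀ i j → Star Adj i j

  Complete : Set
  Complete = ∀ i j → i ≢ j → Adj i j

  Edgeless : Set
  Edgeless = ∀ i j → ¬ Adj i j

  Homogeneous : Set
  Homogeneous = (∀ i j → ¬ NegEdge i j) ⊎ (∀ i j → ¬ PosEdge i j)

  Inhomogeneous : Set
  Inhomogeneous = ¬ Homogeneous

  IsSRSG : ℕ → ℤ → ℤ → ℤ → Set
  IsSRSG r a b c =
      ¬ (Homogeneous × Complete)
    × ¬ Edgeless
    × (∀ i → A² i i ≡ + r)
    × (∀ i j → PosEdge i j → A² i j ≡ a)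
    × (∀ i j → NegEdge i j → A² i j ≡ b)
    × (∀ i j → i ≢ j → ¬ Adj i j → A² i j ≡ c)

  -- classes of inhomogeneous SRSGs (c ≠ (a+b)/2 written as 2c ≠ a+b)
  InC₁ InC₄ InC₅ : ℤ → ℤ → ℤ → Set
  InC₁ a b c = Inhomogeneous × a ≡ ℤ.- b × (Complete ⊎ (¬ Complete × c ≢ + 0))
  InC₄ a b c = Inhomogeneous × a ≢ ℤ.- b × ¬ Complete × c ≡ + 0
  InC₅ a b c = Inhomogeneous × a ≢ ℤ.- b × ¬ Complete
               × (+ 2) ℤ.* c ≢ a ℤ.+ b × c ≢ + 0

-- Write G's row sums of A² in two ways.  Net-regularity with net-degree 1
-- gives Σⱼ (A²)ᵢⱼ = Σₖ Aᵢₖ · 1 = 1.  Strong regularity with (a, b) = (2, 0)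
-- gives (A²)ᵢⱼ = c + Aᵢⱼ + (1 − c)|Aᵢⱼ| off the diagonal and 5 on it, so
-- Σⱼ (A²)ᵢⱼ = 11 + c(n − 6) by 5-regularity.  Hence c(n − 6) = −10, so
-- n − 6 divides 10, while the handshake lemma makes 5n even; the only
-- possibilities are n ∈ {4, 8, 16}.
module Submission where

open import Defs
open import Data.Nat using (ℕ)
open import Data.Nat.Divisibility using (_∣_)
open import Data.Integer using (ℤ; +_)
open import Data.Sum using (_⊎_)
open import Relation.Nullary using (¬_)
open import Relation.Binary.PropositionalEquality using (_≡_)

open import Data.Nat as ℕ using (zero; suc; _<_; _≤_; s≤s; z≤n)
import Data.Nat.Properties as ℕ
open import Data.Nat.Divisibility using (divides; _∣?_; _∣0; ∣⇒≤)
open import Data.Integer as ℤ using (0ℤ; 1ℤ; -_; ∣_∣)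
import Data.Integer.Properties as ℤ
open import Data.Integer.Tactic.RingSolver using (solve-∀)
open import Data.Nat.Tactic.RingSolver using () renaming (solve-∀ to ℕ-solve-∀)
import Algebra.Properties.CommutativeSemigroup as CommutativeSemigroupProperties
open import Data.Fin using (Fin; zero; suc)
import Data.Fin.Properties as Fin
open import Data.Product using (_,_)
open import Data.Sum using (inj₁; inj₂)
open import Function using (_∘_)
open import Relation.Nullary using (yes; no)
open import Relation.Nullary.Decidable using (_→-dec_; from-yes)
open import Relation.Binary.PropositionalEquality
  using (_≢_; refl; sym; trans; cong; cong₂; subst; module ≡-Reasoning)

open CommutativeSemigroupProperties ℤ.+-commutativeSemigroup
  using () renaming (interchange to ℤ-+-interchange)
open CommutativeSemigroupProperties ℕ.+-commutativeSemigroup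
  using () renaming (interchange to ℕ-+-interchange)

Σℤ-cong : ∀ n {f g : Fin n → ℤ} → (∀ k → f k ≡ g k) → Σℤ n f ≡ Σℤ n g
Σℤ-cong zero    f≗g = refl
Σℤ-cong (suc n) f≗g = cong₂ ℤ._+_ (f≗g zero) (Σℤ-cong n (f≗g ∘ suc))

Σℤ-zero : ∀ n {f : Fin n → ℤ} → (∀ k → f k ≡ 0ℤ) → Σℤ n f ≡ 0ℤ
Σℤ-zero zero    f≗0 = refl
Σℤ-zero (suc n) f≗0 = cong₂ ℤ._+_ (f≗0 zero) (Σℤ-zero n (f≗0 ∘ suc))

Σℤ-const : ∀ n x → Σℤ n (λ _ → x) ≡ + n ℤ.* x
Σℤ-const zero    x = sym (ℤ.*-zeroˡ x)
Σℤ-const (suc n) x = trans (cong (ℤ._+_ x) (Σℤ-const n x)) (sym (ℤ.suc-* (+ n) x))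

Σℤ-distrib-+ : ∀ n (f g : Fin n → ℤ) →
               Σℤ n (λ k → f k ℤ.+ g k) ≡ Σℤ n f ℤ.+ Σℤ n g
Σℤ-distrib-+ zero    f g = refl
Σℤ-distrib-+ (suc n) f g =
  trans (cong (ℤ._+_ (f zero ℤ.+ g zero)) (Σℤ-distrib-+ n (f ∘ suc) (g ∘ suc)))
        (ℤ-+-interchange (f zero) (g zero) _ _)

*-distribˡ-Σℤ : ∀ n x (f : Fin n → ℤ) → x ℤ.* Σℤ n f ≡ Σℤ n (λ k → x ℤ.* f k)
*-distribˡ-Σℤ zero    x f = ℤ.*-zeroʳ x
*-distribˡ-Σℤ (suc n) x f =
  trans (ℤ.*-distribˡ-+ x (f zero) _) (cong (ℤ._+_ (x ℤ.* f zero)) (*-distribˡ-Σℤ n x (f ∘ suc)))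

Σℤ-comm : ∀ m n (f : Fin m → Fin n → ℤ) →
          Σℤ m (λ i → Σℤ n (f i)) ≡ Σℤ n (λ j → Σℤ m (λ i → f i j))
Σℤ-comm zero    n f = sym (Σℤ-zero n (λ _ → refl))
Σℤ-comm (suc m) n f =
  trans (cong (ℤ._+_ (Σℤ n (f zero))) (Σℤ-comm m n (f ∘ suc)))
        (sym (Σℤ-distrib-+ n (f zero) _))

Σℤ-supported : ∀ n (f : Fin n → ℤ) i → (∀ j → j ≢ i → f j ≡ 0ℤ) → Σℤ n f ≡ f i
Σℤ-supported (suc n) f zero    f≗0 =
  trans (cong (ℤ._+_ (f zero)) (Σℤ-zero n (λ j → f≗0 (suc j) (λ ())))) (ℤ.+-identityʳ (f zero))
Σℤ-supported (suc n) f (suc i) f≗0 =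
  trans (cong (ℤ._+ Σℤ n (f ∘ suc)) (f≗0 zero (λ ()))) (trans (ℤ.+-identityˡ _)
        (Σℤ-supported n (f ∘ suc) i (λ j j≢i → f≗0 (suc j) (j≢i ∘ Fin.suc-injective))))

+-Σℕ : ∀ n (f : Fin n → ℕ) → + Σℕ n f ≡ Σℤ n (+_ ∘ f)
+-Σℕ zero    f = refl
+-Σℕ (suc n) f = cong (ℤ._+_ (+ f zero)) (+-Σℕ n (f ∘ suc))

Σℕ-cong : ∀ n {f g : Fin n → ℕ} → (∀ k → f k ≡ g k) → Σℕ n f ≡ Σℕ n g
Σℕ-cong zero    f≗g = refl
Σℕ-cong (suc n) f≗g = cong₂ ℕ._+_ (f≗g zero) (Σℕ-cong n (f≗g ∘ suc))

Σℕ-const : ∀ n x → Σℕ n (λ _ → x) ≡ n ℕ.* x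
Σℕ-const zero    x = refl
Σℕ-const (suc n) x = cong (x ℕ.+_) (Σℕ-const n x)

Σℕ-distrib-+ : ∀ n (f g : Fin n → ℕ) →
               Σℕ n (λ k → f k ℕ.+ g k) ≡ Σℕ n f ℕ.+ Σℕ n g
Σℕ-distrib-+ zero    f g = refl
Σℕ-distrib-+ (suc n) f g =
  trans (cong (f zero ℕ.+ g zero ℕ.+_) (Σℕ-distrib-+ n (f ∘ suc) (g ∘ suc)))
        (ℕ-+-interchange (f zero) (g zero) _ _)

-- Peeling off the first row and column adds twice their common sum.
Σℕ-symmetric-even : ∀ n (f : Fin n → Fin n → ℕ) →
                    (∀ i j → f i j ≡ f j i) → (∀ i → f i i ≡ 0) →
                    2 ∣ Σℕ n (λ i → Σℕ n (f i))
Σℕ-symmetric-even zero    f sym-f diag-f = 2 ∣0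
Σℕ-symmetric-even (suc n) f sym-f diag-f with
  Σℕ-symmetric-even n (λ i j → f (suc i) (suc j))
    (λ i j → sym-f (suc i) (suc j)) (diag-f ∘ suc)
... | divides q inner≡q*2 = divides (row ℕ.+ q) total≡
  where
  open ≡-Reasoning
  row : ℕ
  row = Σℕ n (f zero ∘ suc)
  total≡ : f zero zero ℕ.+ row ℕ.+ Σℕ n (λ i → f (suc i) zero ℕ.+ Σℕ n (f (suc i) ∘ suc))
           ≡ (row ℕ.+ q) ℕ.* 2
  total≡ = begin
    f zero zero ℕ.+ row ℕ.+ Σℕ n (λ i → f (suc i) zero ℕ.+ Σℕ n (f (suc i) ∘ suc))
      ≡⟨ cong₂ (λ d s → d ℕ.+ row ℕ.+ s) (diag-f zero) (Σℕ-distrib-+ n _ _) ⟩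
    row ℕ.+ (Σℕ n (λ i → f (suc i) zero) ℕ.+ Σℕ n (λ i → Σℕ n (f (suc i) ∘ suc)))
      ≡⟨ cong₂ (λ col inner → row ℕ.+ (col ℕ.+ inner))
               (Σℕ-cong n (λ i → sym-f (suc i) zero)) inner≡q*2 ⟩
    row ℕ.+ (row ℕ.+ q ℕ.* 2)
      ≡⟨ collect-2 row q ⟩
    (row ℕ.+ q) ℕ.* 2 ∎
    where
    collect-2 : ∀ r q → r ℕ.+ (r ℕ.+ q ℕ.* 2) ≡ (r ℕ.+ q) ℕ.* 2
    collect-2 = ℕ-solve-∀

entryFormula : ℤ → ℤ → ℤ → ℤ → ℤ
entryFormula c x y t = c ℤ.+ x ℤ.* t ℤ.+ y ℤ.* + ∣ t ∣

module _ {n : ℕ} (G : SignedGraph n) where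
  open SignedGraph G

  regular⇒2∣n*r : ∀ {r} → Regular G r → 2 ∣ n ℕ.* r
  regular⇒2∣n*r {r} regular =
    subst (2 ∣_) (trans (Σℕ-cong n regular) (Σℕ-const n r))
      (Σℕ-symmetric-even n (λ i k → ∣ A i k ∣)
        (λ i j → cong ∣_∣ (symm i j)) (cong ∣_∣ ∘ loopless))

  A²-rowSum : ∀ i → Σℤ n (A² G i) ≡ Σℤ n (λ k → A i k ℤ.* netDegree G k)
  A²-rowSum i = begin
    Σℤ n (λ j → Σℤ n (λ k → A i k ℤ.* A k j))  ≡⟨ Σℤ-comm n n _ ⟩
    Σℤ n (λ k → Σℤ n (λ j → A i k ℤ.* A k j))
      ≡⟨ Σℤ-cong n (λ k → sym (*-distribˡ-Σℤ n (A i k) (A k))) ⟩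
    Σℤ n (λ k → A i k ℤ.* netDegree G k)       ∎
    where open ≡-Reasoning

  A²-rowSum-netRegular : ∀ {ρ} → NetRegular G ρ → ∀ i → Σℤ n (A² G i) ≡ ρ ℤ.* ρ
  A²-rowSum-netRegular {ρ} netRegular i = begin
    Σℤ n (A² G i)                         ≡⟨ A²-rowSum i ⟩
    Σℤ n (λ k → A i k ℤ.* netDegree G k)
      ≡⟨ Σℤ-cong n (λ k → trans (cong (A i k ℤ.*_) (netRegular k)) (ℤ.*-comm (A i k) ρ)) ⟩
    Σℤ n (λ k → ρ ℤ.* A i k)              ≡⟨ sym (*-distribˡ-Σℤ n ρ (A i)) ⟩
    ρ ℤ.* netDegree G i                   ≡⟨ cong (ρ ℤ.*_) (netRegular i) ⟩
    ρ ℤ.* ρ                               ∎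
    where open ≡-Reasoning

  A²-offDiagonal : ∀ {r a b c x y} → IsSRSG G r a b c →
                   a ≡ c ℤ.+ x ℤ.+ y → b ≡ c ℤ.- x ℤ.+ y →
                   ∀ i j → i ≢ j → A² G i j ≡ entryFormula c x y (A i j)
  A²-offDiagonal {c = c} {x} {y} (_ , _ , _ , pos , neg , nonAdj) a≡ b≡ i j i≢j
    with entry i j
  ... | inj₁ Aij≡0 rewrite Aij≡0 =
    trans (nonAdj i j i≢j (λ Aij≢0 → Aij≢0 Aij≡0)) (zeroEntry c x y)
    where
    zeroEntry : ∀ c x y → c ≡ c ℤ.+ x ℤ.* 0ℤ ℤ.+ y ℤ.* 0ℤ
    zeroEntry = solve-∀
  ... | inj₂ (inj₁ Aij≡1) rewrite Aij≡1 =
    trans (pos i j Aij≡1) (trans a≡ (positiveEntry c x y))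
    where
    positiveEntry : ∀ c x y → c ℤ.+ x ℤ.+ y ≡ c ℤ.+ x ℤ.* 1ℤ ℤ.+ y ℤ.* 1ℤ
    positiveEntry = solve-∀
  ... | inj₂ (inj₂ Aij≡-1) rewrite Aij≡-1 =
    trans (neg i j Aij≡-1) (trans b≡ (negativeEntry c x y))
    where
    negativeEntry : ∀ c x y → c ℤ.- x ℤ.+ y ≡ c ℤ.+ x ℤ.* - 1ℤ ℤ.+ y ℤ.* 1ℤ
    negativeEntry = solve-∀

  Σ-entryFormula : ∀ c x y i →
                   Σℤ n (λ j → entryFormula c x y (A i j))
                   ≡ + n ℤ.* c ℤ.+ x ℤ.* netDegree G i ℤ.+ y ℤ.* + degree G i
  Σ-entryFormula c x y i = begin
    Σℤ n (λ j → c ℤ.+ x ℤ.* A i j ℤ.+ y ℤ.* + ∣ A i j ∣)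
      ≡⟨ Σℤ-distrib-+ n _ _ ⟩
    Σℤ n (λ j → c ℤ.+ x ℤ.* A i j) ℤ.+ Σℤ n (λ j → y ℤ.* + ∣ A i j ∣)
      ≡⟨ cong₂ ℤ._+_ (Σℤ-distrib-+ n _ _) (sym (*-distribˡ-Σℤ n y _)) ⟩
    Σℤ n (λ _ → c) ℤ.+ Σℤ n (λ j → x ℤ.* A i j) ℤ.+ y ℤ.* Σℤ n (λ j → + ∣ A i j ∣)
      ≡⟨ cong₂ ℤ._+_ (cong₂ ℤ._+_ (Σℤ-const n c) (sym (*-distribˡ-Σℤ n x (A i))))
                     (cong (y ℤ.*_) (sym (+-Σℕ n _))) ⟩
    + n ℤ.* c ℤ.+ x ℤ.* netDegree G i ℤ.+ y ℤ.* + degree G i ∎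
    where open ≡-Reasoning

  -- Off the diagonal A² agrees with the entry formula, so only the
  -- diagonal term (A²)ᵢᵢ − c = r − c survives in the difference.
  A²-rowSum-SRSG : ∀ {r a b c x y} → IsSRSG G r a b c →
                   a ≡ c ℤ.+ x ℤ.+ y → b ≡ c ℤ.- x ℤ.+ y → ∀ i →
                   Σℤ n (A² G i)
                   ≡ (+ r ℤ.- c) ℤ.+ (+ n ℤ.* c ℤ.+ x ℤ.* netDegree G i ℤ.+ y ℤ.* + degree G i)
  A²-rowSum-SRSG {r} {c = c} {x} {y} srsg@(_ , _ , diag , _) a≡ b≡ i = begin
    Σℤ n (A² G i)                 ≡⟨ Σℤ-cong n (λ j → split (A² G i j) (formula j)) ⟩
    Σℤ n (λ j → excess j ℤ.+ formula j)
                                  ≡⟨ Σℤ-distrib-+ n excess formula ⟩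
    Σℤ n excess ℤ.+ Σℤ n formula  ≡⟨ cong₂ ℤ._+_ excess-sum (Σ-entryFormula c x y i) ⟩
    (+ r ℤ.- c) ℤ.+ (+ n ℤ.* c ℤ.+ x ℤ.* netDegree G i ℤ.+ y ℤ.* + degree G i) ∎
    where
    open ≡-Reasoning
    formula excess : Fin n → ℤ
    formula j = entryFormula c x y (A i j)
    excess j = A² G i j ℤ.- formula j
    split : ∀ s t → s ≡ (s ℤ.- t) ℤ.+ t
    split = solve-∀
    diagonalExcess : ∀ d c x y → d ℤ.- (c ℤ.+ x ℤ.* 0ℤ ℤ.+ y ℤ.* 0ℤ) ≡ d ℤ.- c
    diagonalExcess = solve-∀
    excess-sum : Σℤ n excess ≡ + r ℤ.- c
    excess-sum = begin
      Σℤ n excess  ≡⟨ Σℤ-supported n excess i (λ j j≢i →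
                        trans (cong (ℤ._- formula j)
                                    (A²-offDiagonal srsg a≡ b≡ i j (j≢i ∘ sym)))
                              (ℤ.+-inverseʳ (formula j))) ⟩
      excess i     ≡⟨ cong₂ (λ d l → d ℤ.- entryFormula c x y l) (diag i) (loopless i) ⟩
      + r ℤ.- (c ℤ.+ x ℤ.* 0ℤ ℤ.+ y ℤ.* 0ℤ) ≡⟨ diagonalExcess (+ r) c x y ⟩
      + r ℤ.- c    ∎

m∸n≤∣m-n∣ : ∀ m n → m ℕ.∸ n ≤ ∣ + m ℤ.- + n ∣
m∸n≤∣m-n∣ m n with n ℕ.≤? m
... | yes n≤m = ℕ.≤-reflexive (sym (cong ∣_∣ (trans (ℤ.m-n≡m⊖n m n) (ℤ.⊖-≥ n≤m))))
... | no  n≰m rewrite ℕ.m≤n⇒m∸n≡0 (ℕ.<⇒≤ (ℕ.≰⇒> n≰m)) = z≤n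

∣m-n∣∣d⇒m≤n+d : ∀ m n d .{{_ : ℕ.NonZero d}} → ∣ + m ℤ.- + n ∣ ∣ d → m ≤ n ℕ.+ d
∣m-n∣∣d⇒m≤n+d m n d ∣m-n∣∣d =
  ℕ.≤-trans (ℕ.m≤n+m∸n m n) (ℕ.+-monoʳ-≤ n (ℕ.≤-trans (m∸n≤∣m-n∣ m n) (∣⇒≤ ∣m-n∣∣d)))

2∣n*5∧∣n-6∣∣10⇒4∣n : ∀ n → 2 ∣ n ℕ.* 5 → ∣ + n ℤ.- + 6 ∣ ∣ 10 → 4 ∣ n
2∣n*5∧∣n-6∣∣10⇒4∣n n 2∣n*5 ∣n-6∣∣10 =
  checkBelow17 (s≤s (∣m-n∣∣d⇒m≤n+d n 6 10 ∣n-6∣∣10)) 2∣n*5 ∣n-6∣∣10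
  where
  checkBelow17 : ∀ {n} → n < 17 → 2 ∣ n ℕ.* 5 → ∣ + n ℤ.- + 6 ∣ ∣ 10 → 4 ∣ n
  checkBelow17 = from-yes
    (ℕ.allUpTo? (λ n → 2 ∣? n ℕ.* 5 →-dec ∣ + n ℤ.- + 6 ∣ ∣? 10 →-dec 4 ∣? n) 17)

lemma3p6 : (n : ℕ) (G : SignedGraph n) (a b c : ℤ)
    → InC₁ G a b c ⊎ InC₄ G a b c ⊎ InC₅ G a b c
    → Connected G
    → ¬ Complete G
    → Regular G 5
    → NetRegular G (+ 1)
    → IsSRSG G 5 a b c
    → a ≡ + 2
    → b ≡ + 0
    → 4 ∣ n
lemma3p6 zero      G a b c _ _ _ _ _ _ _ _ = 4 ∣0
lemma3p6 n@(suc _) G a b c _ _ _ regular netRegular srsg refl refl =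
  2∣n*5∧∣n-6∣∣10⇒4∣n n (regular⇒2∣n*r G regular) (divides ∣ c ∣ 10≡∣c∣*∣n-6∣)
  where
  open ≡-Reasoning
  -- (a, b) = (2, 0) is the entry formula with x = 1 and y = 1 − c.
  a≡formula : ∀ c → + 2 ≡ c ℤ.+ 1ℤ ℤ.+ (1ℤ ℤ.- c)
  a≡formula = solve-∀
  b≡formula : ∀ c → + 0 ≡ c ℤ.- 1ℤ ℤ.+ (1ℤ ℤ.- c)
  b≡formula = solve-∀
  rowSum≡1 : (+ 5 ℤ.- c) ℤ.+ (+ n ℤ.* c ℤ.+ 1ℤ ℤ.* 1ℤ ℤ.+ (1ℤ ℤ.- c) ℤ.* + 5) ≡ 1ℤ
  rowSum≡1 = begin
    (+ 5 ℤ.- c) ℤ.+ (+ n ℤ.* c ℤ.+ 1ℤ ℤ.* 1ℤ ℤ.+ (1ℤ ℤ.- c) ℤ.* + 5)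
      ≡⟨ cong₂ (λ ρ d → (+ 5 ℤ.- c) ℤ.+ (+ n ℤ.* c ℤ.+ 1ℤ ℤ.* ρ ℤ.+ (1ℤ ℤ.- c) ℤ.* + d))
               (sym (netRegular zero)) (sym (regular zero)) ⟩
    (+ 5 ℤ.- c) ℤ.+ (+ n ℤ.* c ℤ.+ 1ℤ ℤ.* netDegree G zero
                                ℤ.+ (1ℤ ℤ.- c) ℤ.* + degree G zero)
      ≡⟨ sym (A²-rowSum-SRSG G srsg (a≡formula c) (b≡formula c) zero) ⟩
    Σℤ n (A² G zero)
      ≡⟨ A²-rowSum-netRegular G netRegular zero ⟩
    1ℤ ∎
  c[n-6]≡-10 : c ℤ.* (+ n ℤ.- + 6) ≡ - + 10
  c[n-6]≡-10 = trans (rearrange c (+ n)) (cong (λ s → s ℤ.- + 11) rowSum≡1)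
    where
    rearrange : ∀ c N → c ℤ.* (N ℤ.- + 6)
                ≡ (+ 5 ℤ.- c) ℤ.+ (N ℤ.* c ℤ.+ 1ℤ ℤ.* 1ℤ ℤ.+ (1ℤ ℤ.- c) ℤ.* + 5) ℤ.- + 11
    rearrange = solve-∀
  10≡∣c∣*∣n-6∣ : 10 ≡ ∣ c ∣ ℕ.* ∣ + n ℤ.- + 6 ∣
  10≡∣c∣*∣n-6∣ = trans (cong ∣_∣ (sym c[n-6]≡-10)) (ℤ.abs-* c _)
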